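{- Let $A$ be a set with a decidable total order. Then there is a function $s\colon M(A)\to L(A)$ that is a section of the canonical surjection $q\colon L(A)\twoheadrightarrow M(A)$, i.e. $q(s(xs))=xs$ for all $xs:M(A)$.
   Context: Univalent type theory. $L(A)$ is the free monoid on $A$ (finite lists), $M(A)$ the free commutative monoid on $A$ (finite multisets, e.g. lists quotiented by permutations) with generator map $\eta_A$, and $q$ is the unique monoid homomorphism $L(A)\to M(A)$ extending $\eta_A$ (sending a list to the multiset of its entries). A total order is a proposition-valued reflexive, transitive, antisymmetric, total relation $\le$; decidable if $(x\le y)+\neg(x\le y)$ for all $x,y$. -}

module Defs where

open import Level using (Level; _⊔_)
open import Data.List using (List)
open import Data.Product using (Σ; _×_)
open import Relation.Binary.PropositionalEquality using (_≡_)
open import Relation.Binary.Structures using (IsDecTotalOrder)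
open import Data.List.Relation.Binary.Permutation.Propositional using (_↭_)

L : ∀ {a} → Set a → Set a
L A = List A

-- M(A): the free commutative monoid on A, presented (without HITs) as the
-- setoid of lists quotiented by permutation: its carrier is List A and its
-- equality is _↭_.  A function out of M(A) is a function on lists that
-- respects _↭_; equality in M(A) is _↭_.
M : ∀ {a} → Set a → Set a
M A = List A

_≈M_ : ∀ {a} {A : Set a} → M A → M A → Set a
xs ≈M ys = xs ↭ ys

q : ∀ {a} {A : Set a} → L A → M A
q xs = xs

IsSet : ∀ {a} → Set a → Set a
IsSet A = ∀ {x y : A} (p r : x ≡ y) → p ≡ r

PropValued : ∀ {a ℓ} {A : Set a} → (A → A → Set ℓ) → Set (a ⊔ ℓ)
PropValued _≤_ = ∀ {x y} (p r : x ≤ y) → p ≡ r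

IsSectionOfq : ∀ {a} {A : Set a} → (M A → L A) → Set a
IsSectionOfq {A = A} s =
  (∀ {xs ys : M A} → xs ≈M ys → s xs ≡ s ys) × (∀ (xs : M A) → q (s xs) ≈M xs)

-- Sorting is a section: the sorted list of a multiset depends only on the
-- multiset, because two sorted lists that are permutations of each other
-- coincide (antisymmetry of the order), and it is a permutation of its input.
module Submission where

open import Defs
open import Data.Product using (Σ; _,_)
open import Data.List using (List)
open import Relation.Binary.PropositionalEquality using (_≡_; isEquivalence)
open import Relation.Binary.Structures using (IsDecTotalOrder)
open import Relation.Binary.Bundles using (DecTotalOrder)
open import Data.List.Relation.Binary.Permutation.Propositional
  using (_↭_; ↭⇒↭ₛ′; ↭-sym; ↭-trans)
open import Data.List.Relation.Binary.Pointwise using (Pointwise-≡⇒≡)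
open import Data.List.Relation.Unary.Sorted.TotalOrder using (Sorted)
import Data.List.Sort as Sort
import Data.List.Relation.Unary.Sorted.TotalOrder.Properties as SortedProperties

module SortSection {a ℓ} {A : Set a} {_≤_ : A → A → Set ℓ}
                   (isDecTotalOrder : IsDecTotalOrder _≡_ _≤_) where

  decTotalOrder : DecTotalOrder a a ℓ
  decTotalOrder = record { isDecTotalOrder = isDecTotalOrder }

  open DecTotalOrder decTotalOrder using (totalOrder)
  open Sort decTotalOrder public using (sort; sort-↭; sort-↗)

  ↗↭↗⇒≡ : ∀ {xs ys : List A} → Sorted totalOrder xs → Sorted totalOrder ys →
          xs ↭ ys → xs ≡ ys
  ↗↭↗⇒≡ xs↗ ys↗ xs↭ys = Pointwise-≡⇒≡
    (SortedProperties.↗↭↗⇒≋ totalOrder xs↗ ys↗ (↭⇒↭ₛ′ isEquivalence xs↭ys))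

  sort-cong-↭ : ∀ {xs ys : List A} → xs ↭ ys → sort xs ≡ sort ys
  sort-cong-↭ {xs} {ys} xs↭ys = ↗↭↗⇒≡ (sort-↗ xs) (sort-↗ ys)
    (↭-trans (sort-↭ xs) (↭-trans xs↭ys (↭-sym (sort-↭ ys))))

  sort-isSectionOfq : IsSectionOfq sort
  sort-isSectionOfq = sort-cong-↭ , sort-↭

-- Set-ness of A and propositionality of ≤ are what make M(A) a set in the
-- univalent reading.
proposition53 : ∀ {a ℓ} (A : Set a) (_≤_ : A → A → Set ℓ) →
    IsSet A → PropValued _≤_ → IsDecTotalOrder _≡_ _≤_ →
    Σ (M A → L A) IsSectionOfq
proposition53 A _≤_ _ _ isDecTotalOrder = sort , sort-isSectionOfq
  where open SortSection isDecTotalOrder
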